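{- Let $G$ be a graph with minimum degree $\delta(G)\geq 1$, and let $m$ be a positive integer with $m > \frac{\chi_\rho(G)}{\delta(G)}$. Then $\chi_\rho(FSSD_m(G)) = \chi_\rho(FSSD_{m+1}(G))$.
   Context: All graphs are finite and simple; $\delta(G)$ denotes the minimum degree of $G$. For a positive integer $i$, an $i$-packing is a set of vertices in which any two distinct vertices are at distance greater than $i$. The packing chromatic number $\chi_\rho(H)$ of a graph $H$ is the smallest integer $k$ such that $V(H)$ can be partitioned into sets $V_1,\dots,V_k$ with each $V_i$ an $i$-packing. For a positive integer $m$, the finite super subdivision graph $FSSD_m(G)$ is obtained from $G$ by replacing each edge $uv$ of $G$ by a complete bipartite graph $K_{2,m}$ whose part of size $2$ is $\{u,v\}$; that is, the edge $uv$ is deleted and $m$ new vertices are added, each adjacent exactly to $u$ and $v$. -}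

module Defs where

open import Data.Nat using (ℕ; zero; suc; _≤_; _<_; _*_)
open import Data.Fin as F using (Fin; toℕ)
open import Data.Bool using (Bool; true; false; T; if_then_else_)
open import Data.List using (List; length; filter; allFin)
open import Data.Sum using (_⊎_; inj₁; inj₂)
open import Data.Product using (Σ; Σ-syntax; ∃; ∃-syntax; _×_; _,_; proj₁; proj₂)
open import Data.Empty using (⊥)
open import Relation.Nullary using (¬_)
open import Relation.Binary.PropositionalEquality using (_≡_; _≢_; refl)
open import Data.Bool.Properties using (T?)

record Graph : Set₁ where
  field
    V      : Set
    Adj    : V → V → Set
    adj-symm : ∀ {u v} → Adj u v → Adj v u
    adj-irr : ∀ {u} → ¬ Adj u u
open Graph public

record FinGraph (n : ℕ) : Set where
  field
    adj       : Fin n → Fin n → Bool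
    adj-sym   : ∀ u v → adj u v ≡ adj v u
    adj-irrefl : ∀ u → adj u u ≡ false
open FinGraph public

toGraph : ∀ {n} → FinGraph n → Graph
toGraph {n} G = record
  { V = Fin n
  ; Adj = λ u v → T (adj G u v)
  ; adj-symm = λ {u} {v} p → subst' (adj-sym G u v) p
  ; adj-irr = λ {u} p → subst'' (adj-irrefl G u) p
  }
  where
    subst' : ∀ {a b : Bool} → a ≡ b → T a → T b
    subst' refl x = x
    subst'' : ∀ {a : Bool} → a ≡ false → T a → ⊥
    subst'' refl ()

degree : ∀ {n} → FinGraph n → Fin n → ℕ
degree {n} G v = length (filter (λ w → T? (adj G v w)) (allFin n))

IsMinDegree : ∀ {n} → FinGraph n → ℕ → Set
IsMinDegree {n} G d = (∃[ v ] degree G v ≡ d) × (∀ v → d ≤ degree G v)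

-- dist(u,v) ≤ i : there is a walk of length at most i from u to v
data WithinDist (G : Graph) : ℕ → V G → V G → Set where
  here : ∀ {i u} → WithinDist G i u u
  step : ∀ {i u w v} → Adj G u w → WithinDist G i w v → WithinDist G (suc i) u v

-- A packing colouring with k colours: colour class of colour j (j = 0..k-1,
-- representing the paper's colour j+1) is a (j+1)-packing.
IsPackingColouring : (G : Graph) (k : ℕ) → (V G → Fin k) → Set
IsPackingColouring G k c =
  ∀ u v → u ≢ v → c u ≡ c v → ¬ WithinDist G (suc (toℕ (c u))) u v

HasPackingColouring : Graph → ℕ → Set
HasPackingColouring G k = Σ[ c ∈ (V G → Fin k) ] IsPackingColouring G k c

IsPackingChromaticNumber : Graph → ℕ → Set
IsPackingChromaticNumber G k =
  HasPackingColouring G k × (∀ k' → HasPackingColouring G k' → k ≤ k')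

Edge : ∀ {n} → FinGraph n → Set
Edge {n} G = Σ[ u ∈ Fin n ] Σ[ v ∈ Fin n ] (u F.< v × T (adj G u v))

endL endR : ∀ {n} {G : FinGraph n} → Edge G → Fin n
endL (u , _ , _) = u
endR (_ , v , _) = v

FSSDV : ∀ {n} → ℕ → FinGraph n → Set
FSSDV {n} m G = Fin n ⊎ (Edge G × Fin m)

FSSDAdj : ∀ {n} (m : ℕ) (G : FinGraph n) → FSSDV m G → FSSDV m G → Set
FSSDAdj m G (inj₁ x) (inj₁ y) = ⊥
FSSDAdj m G (inj₁ x) (inj₂ (e , j)) = x ≡ endL {G = G} e ⊎ x ≡ endR {G = G} e
FSSDAdj m G (inj₂ (e , j)) (inj₁ x) = x ≡ endL {G = G} e ⊎ x ≡ endR {G = G} e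
FSSDAdj m G (inj₂ _) (inj₂ _) = ⊥

FSSDAdj-sym : ∀ {n} m (G : FinGraph n) {a b} → FSSDAdj m G a b → FSSDAdj m G b a
FSSDAdj-sym m G {inj₁ x} {inj₂ y} p = p
FSSDAdj-sym m G {inj₂ y} {inj₁ x} p = p

FSSDAdj-irrefl : ∀ {n} m (G : FinGraph n) {a} → ¬ FSSDAdj m G a a
FSSDAdj-irrefl m G {inj₁ x} ()
FSSDAdj-irrefl m G {inj₂ y} ()

FSSD : ∀ {n} → ℕ → FinGraph n → Graph
FSSD m G = record
  { V = FSSDV m G
  ; Adj = FSSDAdj m G
  ; adj-symm = FSSDAdj-sym m G
  ; adj-irr = FSSDAdj-irrefl m G
  }

module Submission where

-- Colours are 0-indexed: colour j must be a (j+1)-packing.  In FSSD_m(G) the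
-- distance between two original vertices is twice their distance in G, and
-- the subdivision vertices are pairwise non-adjacent.  Call a colouring of G
-- with k colours a half-packing colouring if colour class j is a
-- (⌊j/2⌋+1)-packing of G: these are exactly the colourings that become packing
-- colourings of FSSD_m(G) after shifting every colour up by one and giving all
-- subdivision vertices colour 0.  Let k₀ be the least k admitting one (it
-- exists and k₀ ≤ χ_ρ(G), since a packing colouring is a half-packing one).
-- We show χ_ρ(FSSD_m(G)) = k₀ + 1 whenever k₀ < m·deg(v) for every vertex v:
--   * the shifted colouring gives the upper bound;
--   * in any packing colouring of FSSD_m(G), an original vertex u of colour 0
--     forces its m·deg(u) subdivision neighbours (pairwise at distance 2) to
--     have distinct non-zero colours, so there are more than m·deg(u) > k₀
--     colours; otherwise no original vertex has colour 0 and shifting down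
--     gives a half-packing colouring of G, so there are more than k₀ colours.
-- Since χ_ρ(G) < m·δ(G) ≤ (m+1)·δ(G), both FSSD_m(G) and FSSD_{m+1}(G) have
-- packing chromatic number k₀ + 1.  Finding k₀ requires deciding the existence
-- of half-packing colourings, which is done by exhaustive search.

open import Defs
open import Data.Nat using (ℕ; zero; suc; _≤_; _<_; _*_; z≤n; s≤s; ⌊_/2⌋)
open import Data.Product using (∃-syntax; _×_; ∃; _,_; proj₁; proj₂; uncurry)
open import Data.Nat.Properties
  using (n≤1+n; ≮⇒≥; <⇒≤; ≤-<-trans; <-≤-trans; n≮0; *-monoˡ-≤; *-monoʳ-≤; ⌊n/2⌋≤n)
open import Data.Fin as F using (Fin; toℕ; remQuot; combine; punchOut)
open import Data.Fin.Properties
  using (_≟_; any?; all?; pigeonhole; <-cmp; <⇒≢; combine-remQuot; punchOut-injective;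
         punchIn-punchOut; ¬∀⟶∃¬-smallest; toℕ-fromℕ; toℕ-fromℕ<; toℕ-inject; suc-injective)
open import Data.Vec as Vec using (Vec; []; _∷_; tabulate)
open import Data.Vec.Properties using (lookup∘tabulate)
open import Data.List as L using (List; filter; allFin)
open import Data.List.Relation.Unary.All as All using ()
open import Data.List.Relation.Unary.AllPairs using (AllPairs; _∷_)
open import Data.List.Relation.Unary.Unique.Propositional.Properties using (allFin⁺; filter⁺)
open import Data.List.Membership.Propositional.Properties using (∈-filter⁻; ∈-lookup)
open import Data.Bool using (T)
open import Data.Bool.Properties using (T?)
open import Data.Sum using (_⊎_; inj₁; inj₂)
open import Data.Sum.Properties using (inj₁-injective; inj₂-injective)
open import Data.Empty using (⊥; ⊥-elim)
open import Function using (_∘_)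
open import Relation.Nullary using (¬_; Dec; yes; no)
open import Relation.Nullary.Decidable using (_×-dec_; _→-dec_; ¬?; decidable-stable)
open import Relation.Binary using (Tri; tri<; tri≈; tri>)
open import Relation.Binary.PropositionalEquality
  using (_≡_; _≢_; refl; sym; trans; cong; subst; module ≡-Reasoning)

⌊n/2⌋*2≤n : ∀ t → ⌊ t /2⌋ * 2 ≤ t
⌊n/2⌋*2≤n zero = z≤n
⌊n/2⌋*2≤n (suc zero) = z≤n
⌊n/2⌋*2≤n (suc (suc t)) = s≤s (s≤s (⌊n/2⌋*2≤n t))

least-witness : (P : ℕ → Set) → (∀ k → Dec (P k)) → ∀ N → P N →
                ∃ λ k → P k × (∀ j → j < k → ¬ P j)
least-witness P P? N pN
  with ¬∀⟶∃¬-smallest (suc N) (λ i → ¬ P (toℕ i)) (λ i → ¬? (P? (toℕ i)))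
         (λ all → all (F.fromℕ N) (subst P (sym (toℕ-fromℕ N)) pN))
... | i , ¬¬Pi , below = toℕ i , decidable-stable (P? (toℕ i)) ¬¬Pi , none-below
  where
  none-below : ∀ j → j < toℕ i → ¬ P j
  none-below j j<i = subst (¬_ ∘ P) (trans (toℕ-inject _) (toℕ-fromℕ< j<i)) (below (F.fromℕ< j<i))

∃-vec? : ∀ {A : Set} → (∀ (Q : A → Set) → (∀ a → Dec (Q a)) → Dec (∃ Q)) →
         ∀ n (P : Vec A n → Set) → (∀ c → Dec (P c)) → Dec (∃ P)
∃-vec? ∃A? zero P P? with P? []
... | yes p = yes ([] , p)
... | no ¬p = no λ { ([] , p) → ¬p p }
∃-vec? ∃A? (suc n) P P? with ∃A? (λ a → ∃ λ v → P (a ∷ v)) (λ a → ∃-vec? ∃A? n (P ∘ (a ∷_)) (P? ∘ (a ∷_)))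
... | yes (a , v , p) = yes (a ∷ v , p)
... | no ¬p = no λ { (a ∷ v , p) → ¬p (a , v , p) }

lookup-injective : ∀ {A : Set} {xs : List A} → AllPairs _≢_ xs →
                   ∀ i j → L.lookup xs i ≡ L.lookup xs j → i ≡ j
lookup-injective (_ ∷ _) F.zero F.zero _ = refl
lookup-injective (x≢ ∷ _) F.zero (F.suc j) eq = ⊥-elim (All.lookup x≢ (∈-lookup j) eq)
lookup-injective (x≢ ∷ _) (F.suc i) F.zero eq = ⊥-elim (All.lookup x≢ (∈-lookup i) (sym eq))
lookup-injective (_ ∷ rest) (F.suc i) (F.suc j) eq = cong F.suc (lookup-injective rest i j eq)

remQuot-injective : ∀ {m} k (i j : Fin (m * k)) → remQuot {m} k i ≡ remQuot k j → i ≡ j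
remQuot-injective {m} k i j eq = begin
  i                               ≡⟨ sym (combine-remQuot {m} k i) ⟩
  uncurry combine (remQuot {m} k i) ≡⟨ cong (uncurry combine) eq ⟩
  uncurry combine (remQuot {m} k j) ≡⟨ combine-remQuot {m} k j ⟩
  j                               ∎
  where open ≡-Reasoning

within-mono : ∀ {H : Graph} {i j u v} → i ≤ j → WithinDist H i u v → WithinDist H j u v
within-mono _ here = here
within-mono (s≤s i≤j) (step a r) = step a (within-mono i≤j r)

-- A vertex x of colour 0 forces its neighbours to have non-zero colours, which
-- are pairwise distinct since the neighbours are mutually within distance 2.
-- Hence N distinct neighbours of x need N colours besides colour 0.
colour-zero-neighbourhood :
  ∀ {H : Graph} {k N} (c : V H → Fin (suc k)) → IsPackingColouring H (suc k) c →
  ∀ x → c x ≡ F.zero → (nb : Fin N → V H) → (∀ i j → nb i ≡ nb j → i ≡ j) →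
  (∀ i → Adj H x (nb i)) → N ≤ k
colour-zero-neighbourhood {H} {k} {N} c packing x cx≡0 nb nb-inj x~nb = ≮⇒≥ too-many
  where
  nonzero : ∀ i → F.zero ≢ c (nb i)
  nonzero i 0≡c = packing x (nb i) (λ { refl → adj-irr H (x~nb i) }) (trans cx≡0 0≡c)
                    (step (x~nb i) here)

  colour≥1 : ∀ i → 1 ≤ toℕ (c (nb i))
  colour≥1 i = subst (λ f → 1 ≤ toℕ f) (punchIn-punchOut (nonzero i)) (s≤s z≤n)

  too-many : k < N → ⊥
  too-many k<N with pigeonhole k<N (λ i → punchOut (nonzero i))
  ... | i , j , i<j , same =
    packing (nb i) (nb j) (<⇒≢ i<j ∘ nb-inj i j) (punchOut-injective (nonzero i) (nonzero j) same)
      (within-mono (s≤s (colour≥1 i)) (step (adj-symm H (x~nb i)) (step (x~nb j) here)))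

module _ {n : ℕ} (G : FinGraph n) where

  private
    GG : Graph
    GG = toGraph G

  within? : ∀ i u v → Dec (WithinDist GG i u v)
  within? zero u v with u ≟ v
  ... | yes refl = yes here
  ... | no u≢v = no λ { here → u≢v refl }
  within? (suc i) u v with u ≟ v
  ... | yes refl = yes here
  ... | no u≢v with any? (λ w → T? (adj G u w) ×-dec within? i w v)
  ...   | yes (w , a , r) = yes (step a r)
  ...   | no ¬w = no λ { here → u≢v refl ; (step a r) → ¬w (_ , a , r) }

  IsHalfPackingColouring : ∀ k → (Fin n → Fin k) → Set
  IsHalfPackingColouring k c =
    ∀ u v → u ≢ v → c u ≡ c v → ¬ WithinDist GG (suc ⌊ toℕ (c u) /2⌋) u v

  -- Colourings are represented by vectors so that they can be enumerated.
  HasHalfPacking : ℕ → Set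
  HasHalfPacking k = ∃ λ (c : Vec (Fin k) n) → IsHalfPackingColouring k (Vec.lookup c)

  has-half-packing? : ∀ k → Dec (HasHalfPacking k)
  has-half-packing? k = ∃-vec? (λ _ → any?) n _ λ c →
    all? λ u → all? λ v → ¬? (u ≟ v) →-dec (Vec.lookup c u ≟ Vec.lookup c v) →-dec ¬? (within? _ u v)

  half-packing-vec : ∀ {k} (c : Fin n → Fin k) → IsHalfPackingColouring k c → HasHalfPacking k
  half-packing-vec {k} c half = tabulate c , tabulated
    where
    tabulated : IsHalfPackingColouring k (Vec.lookup (tabulate c))
    tabulated u v rewrite lookup∘tabulate c u | lookup∘tabulate c v = half u v

  packing⇒half : ∀ {k} (c : Fin n → Fin k) → IsPackingColouring GG k c → IsHalfPackingColouring k c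
  packing⇒half c packing u v u≢v same W = packing u v u≢v same (within-mono (s≤s (⌊n/2⌋≤n _)) W)

  neighbour : ∀ u → Fin (degree G u) → Fin n
  neighbour u = L.lookup (filter (λ w → T? (adj G u w)) (allFin n))

  neighbour-adj : ∀ u i → T (adj G u (neighbour u i))
  neighbour-adj u i = proj₂ (∈-filter⁻ (λ w → T? (adj G u w)) {xs = allFin n} (∈-lookup i))

  neighbour-injective : ∀ u i j → neighbour u i ≡ neighbour u j → i ≡ j
  neighbour-injective u = lookup-injective (filter⁺ (λ w → T? (adj G u w)) (allFin⁺ n))

  orient : ∀ u w → T (adj G u w) → Tri (u F.< w) (u ≡ w) (w F.< u) → Edge G
  orient u w a (tri< u<w _ _) = u , w , u<w , a
  orient u .u a (tri≈ _ refl _) = ⊥-elim (adj-irr GG a)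
  orient u w a (tri> _ _ w<u) = w , u , w<u , adj-symm GG a

  edgeOf : ∀ u w → T (adj G u w) → Edge G
  edgeOf u w a = orient u w a (<-cmp u w)

  -- x is an endpoint of e; this is adjacency of x and a subdivision vertex of e.
  IsEnd : Fin n → Edge G → Set
  IsEnd x e = x ≡ endL {G = G} e ⊎ x ≡ endR {G = G} e

  orient-endˡ : ∀ u w a t → IsEnd u (orient u w a t)
  orient-endˡ u w a (tri< _ _ _) = inj₁ refl
  orient-endˡ u .u a (tri≈ _ refl _) = ⊥-elim (adj-irr GG a)
  orient-endˡ u w a (tri> _ _ _) = inj₂ refl

  orient-endʳ : ∀ u w a t → IsEnd w (orient u w a t)
  orient-endʳ u w a (tri< _ _ _) = inj₂ refl
  orient-endʳ u .u a (tri≈ _ refl _) = ⊥-elim (adj-irr GG a)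
  orient-endʳ u w a (tri> _ _ _) = inj₁ refl

  orient-ends : ∀ u w a t x → IsEnd x (orient u w a t) → x ≡ u ⊎ x ≡ w
  orient-ends u w a (tri< _ _ _) x end = end
  orient-ends u .u a (tri≈ _ refl _) x _ = ⊥-elim (adj-irr GG a)
  orient-ends u w a (tri> _ _ _) x (inj₁ x≡w) = inj₂ x≡w
  orient-ends u w a (tri> _ _ _) x (inj₂ x≡u) = inj₁ x≡u

  edgeOf-injective : ∀ u w w' a a' → edgeOf u w a ≡ edgeOf u w' a' → w ≡ w'
  edgeOf-injective u w w' a a' eq
    with orient-ends u w' a' (<-cmp u w') w (subst (IsEnd w) eq (orient-endʳ u w a (<-cmp u w)))
  ... | inj₁ refl = ⊥-elim (adj-irr GG a)
  ... | inj₂ w≡w' = w≡w'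

  ends-adjacent : ∀ (e : Edge G) {x y} → IsEnd x e → IsEnd y e → x ≡ y ⊎ T (adj G x y)
  ends-adjacent _ (inj₁ refl) (inj₁ refl) = inj₁ refl
  ends-adjacent (_ , _ , _ , a) (inj₁ refl) (inj₂ refl) = inj₂ a
  ends-adjacent (_ , _ , _ , a) (inj₂ refl) (inj₁ refl) = inj₂ (adj-symm GG a)
  ends-adjacent _ (inj₂ refl) (inj₂ refl) = inj₁ refl

  -- A walk in FSSD_m(G) between original vertices alternates original and
  -- subdivision vertices, so it shadows a walk in G of half the length.
  contract : ∀ {m i u v} → WithinDist (FSSD m G) i (inj₁ u) (inj₁ v) → WithinDist GG ⌊ i /2⌋ u v
  contract here = here
  contract {m} (step {w = inj₂ (e , _)} a₁ (step {w = inj₁ _} a₂ r)) with ends-adjacent e a₁ a₂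
  ... | inj₁ refl = within-mono (n≤1+n _) (contract {m} r)
  ... | inj₂ a = step a (contract {m} r)

  -- Conversely every edge of G is a path of length 2 in FSSD_{m+1}(G).
  expand : ∀ {m i u v} → WithinDist GG i u v → WithinDist (FSSD (suc m) G) (i * 2) (inj₁ u) (inj₁ v)
  expand here = here
  expand {m} {u = u} (step {w = w} a r) =
    step {w = inj₂ (edgeOf u w a , F.zero)} (orient-endˡ u w a (<-cmp u w))
      (step (orient-endʳ u w a (<-cmp u w)) (expand {m} r))

  lift : ∀ {m k} → (Fin n → Fin k) → FSSDV m G → Fin (suc k)
  lift c (inj₁ u) = F.suc (c u)
  lift c (inj₂ _) = F.zero

  lift-packing : ∀ {m k} (c : Fin n → Fin k) → IsHalfPackingColouring k c →
                 IsPackingColouring (FSSD m G) (suc k) (lift c)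
  lift-packing {m} c half (inj₁ u) (inj₁ v) u≢v same W =
    half u v (u≢v ∘ cong inj₁) (suc-injective same) (contract {m} W)
  lift-packing c half (inj₁ _) (inj₂ _) _ () _
  lift-packing c half (inj₂ _) (inj₁ _) _ () _
  lift-packing c half (inj₂ _) (inj₂ _) s≢t _ here = s≢t refl
  lift-packing c half (inj₂ _) (inj₂ _) _ _ (step {w = inj₁ _} _ ())
  lift-packing c half (inj₂ _) (inj₂ _) _ _ (step {w = inj₂ _} () _)

  half-from-nonzero : ∀ {m k} (c : FSSDV (suc m) G → Fin (suc k)) →
                      IsPackingColouring (FSSD (suc m) G) (suc k) c →
                      (nz : ∀ u → F.zero ≢ c (inj₁ u)) →
                      IsHalfPackingColouring k (λ u → punchOut (nz u))
  half-from-nonzero {m} c packing nz u v u≢v same W =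
    packing (inj₁ u) (inj₁ v) (u≢v ∘ inj₁-injective) (punchOut-injective (nz u) (nz v) same)
      (subst (λ f → WithinDist (FSSD (suc m) G) (suc (toℕ f)) (inj₁ u) (inj₁ v))
        (punchIn-punchOut (nz u))
        (within-mono (s≤s (s≤s (⌊n/2⌋*2≤n _))) (expand {m} W)))

  spoke : ∀ {m} u → Fin m × Fin (degree G u) → FSSDV m G
  spoke u (r , q) = inj₂ (edgeOf u (neighbour u q) (neighbour-adj u q) , r)

  spoke-adj : ∀ {m} u p → FSSDAdj m G (inj₁ u) (spoke u p)
  spoke-adj u (_ , q) = orient-endˡ u (neighbour u q) (neighbour-adj u q) (<-cmp u (neighbour u q))

  spoke-injective : ∀ {m} u p p' → spoke {m} u p ≡ spoke u p' → p ≡ p'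
  spoke-injective u (r , q) (r' , q') eq with inj₂-injective eq
  ... | same-edge
    with neighbour-injective u q q'
           (edgeOf-injective u _ _ (neighbour-adj u q) (neighbour-adj u q') (cong proj₁ same-edge))
  ... | refl = cong (_, q) (cong proj₂ same-edge)

  zero-coloured-original : ∀ {m k} (c : FSSDV m G → Fin (suc k)) →
                           IsPackingColouring (FSSD m G) (suc k) c →
                           ∀ u → c (inj₁ u) ≡ F.zero → m * degree G u ≤ k
  zero-coloured-original {m} c packing u cu≡0 =
    colour-zero-neighbourhood c packing (inj₁ u) cu≡0 (spoke u ∘ remQuot {m} (degree G u))
      (λ i j eq → remQuot-injective {m} (degree G u) i j (spoke-injective u _ _ eq))
      (λ i → spoke-adj u (remQuot {m} (degree G u) i))

  fssd-packing-chromatic : ∀ {m k} → Fin n → HasHalfPacking k → (∀ j → j < k → ¬ HasHalfPacking j) →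
                           (∀ v → k < m * degree G v) → IsPackingChromaticNumber (FSSD m G) (suc k)
  fssd-packing-chromatic {zero} v₀ _ _ few = ⊥-elim (n≮0 (few v₀))
  fssd-packing-chromatic {suc m} {k} v₀ (c , half) minimal few =
    (lift (Vec.lookup c) , lift-packing _ half) , lower-bound
    where
    lower-bound : ∀ k' → HasPackingColouring (FSSD (suc m) G) k' → suc k ≤ k'
    lower-bound zero (c' , _) with c' (inj₁ v₀)
    ... | ()
    lower-bound (suc k') (c' , packing) with any? (λ u → F.zero ≟ c' (inj₁ u))
    ... | yes (u , 0≡cu) =
      s≤s (<⇒≤ (<-≤-trans (few u) (zero-coloured-original c' packing u (sym 0≡cu))))
    ... | no none = s≤s (≮⇒≥ λ k'<k →
      minimal k' k'<k (half-packing-vec _ (half-from-nonzero c' packing (λ u 0≡cu → none (u , 0≡cu)))))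

proposition5 : ∀ {n} (G : FinGraph n) (δ χ m : ℕ)
    → IsMinDegree G δ → 1 ≤ δ
    → IsPackingChromaticNumber (toGraph G) χ
    → 1 ≤ m → χ < m * δ
    → ∃[ k ] (IsPackingChromaticNumber (FSSD m G) k × IsPackingChromaticNumber (FSSD (suc m) G) k)
proposition5 G δ χ m ((v₀ , _) , δ≤deg) _ ((c₀ , packing₀) , _) _ χ<mδ
  with least-witness (HasHalfPacking G) (has-half-packing? G) χ
         (half-packing-vec G c₀ (packing⇒half G c₀ packing₀))
... | k₀ , half₀ , minimal =
  suc k₀ , fssd-packing-chromatic G v₀ half₀ minimal (few m χ<mδ)
         , fssd-packing-chromatic G v₀ half₀ minimal (few (suc m) (<-≤-trans χ<mδ (*-monoˡ-≤ δ (n≤1+n m))))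
  where
  k₀≤χ : k₀ ≤ χ
  k₀≤χ = ≮⇒≥ λ χ<k₀ → minimal χ χ<k₀ (half-packing-vec G c₀ (packing⇒half G c₀ packing₀))

  few : ∀ m' → χ < m' * δ → ∀ v → k₀ < m' * degree G v
  few m' χ<m'δ v = ≤-<-trans k₀≤χ (<-≤-trans χ<m'δ (*-monoʳ-≤ m' (δ≤deg v)))
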